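{- Let $H$ be a finite connected graph, possibly with multiple edges, and let $Q_1,\dots,Q_h$ be pairwise vertex-disjoint cycles in $H$. For every $x,y\in V(H)$ there exists an $(x,y)$-path $P$ in $H$ such that for every $i$ with $1\le i\le h$, the intersection $P\cap Q_i$ is either empty or a segment (subpath) of $Q_i$ containing at most half of the edges of $Q_i$.
   Context: Cycles may have length $2$ (a pair of parallel edges). -}

module Defs where

open import Data.Nat using (ℕ; zero; suc; _+_; _*_; _≤_; _<_)
open import Data.Nat.DivMod using (_mod_)
open import Data.Fin using (Fin; inject₁; fromℕ) renaming (zero to fzero; suc to fsuc)
open import Data.Product using (Σ; ∃; ∃-syntax; _×_; _,_)
open import Data.Sum using (_⊎_)
open import Relation.Binary.PropositionalEquality using (_≡_; _≢_)
open import Relation.Nullary using (¬_)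
open import Function.Definitions using (Injective)
open import Function.Bundles using (_⇔_)

record Multigraph : Set where
  field
    n m  : ℕ
    src  : Fin m → Fin n
    tgt  : Fin m → Fin n
    loopless : ∀ e → src e ≢ tgt e

  V : Set
  V = Fin n

  E : Set
  E = Fin m

  Joins : E → V → V → Set
  Joins e u v = (src e ≡ u × tgt e ≡ v) ⊎ (src e ≡ v × tgt e ≡ u)

  data Walk : V → V → Set where
    [] : ∀ {x} → Walk x x
    step : ∀ {x y z} (e : E) → Joins e x y → Walk y z → Walk x z

  Connected : Set
  Connected = ∀ x y → Walk x y

  record Path (x y : V) : Set where
    field
      k     : ℕ
      vert  : Fin (suc k) → V
      vert-inj : Injective _≡_ _≡_ vert
      edge  : Fin k → E
      edge-joins : ∀ i → Joins (edge i) (vert (inject₁ i)) (vert (fsuc i))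
      start : vert fzero ≡ x
      end   : vert (fromℕ k) ≡ y

  -- a cycle of length ℓ = 2 + k (ℓ ≥ 2; length 2 = pair of parallel edges):
  -- pairwise distinct vertices v_0 … v_{ℓ-1}, pairwise distinct edges
  -- e_0 … e_{ℓ-1}, edge e_i joining v_i and v_{(i+1) mod ℓ}
  record Cycle : Set where
    field
      k     : ℕ
      vert  : Fin (2 + k) → V
      vert-inj : Injective _≡_ _≡_ vert
      edge  : Fin (2 + k) → E
      edge-inj : Injective _≡_ _≡_ edge
      edge-joins : ∀ (i : Fin (2 + k)) →
        Joins (edge i) (vert i) (vert ((suc (Data.Fin.toℕ i)) mod (2 + k)))

    len : ℕ
    len = 2 + k

    vAt : ℕ → V
    vAt j = vert (j mod (2 + k))

    eAt : ℕ → E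
    eAt j = edge (j mod (2 + k))

  open Path public
  open Cycle public

  _∈Pv_ : ∀ {x y} → V → Path x y → Set
  v ∈Pv P = ∃[ i ] vert P i ≡ v

  _∈Pe_ : ∀ {x y} → E → Path x y → Set
  e ∈Pe P = ∃[ i ] edge P i ≡ e

  _∈Cv_ : V → Cycle → Set
  v ∈Cv Q = ∃[ i ] vert Q i ≡ v

  _∈Ce_ : E → Cycle → Set
  e ∈Ce Q = ∃[ i ] edge Q i ≡ e

  InSegV : Cycle → ℕ → ℕ → V → Set
  InSegV Q j t v = ∃[ s ] (s ≤ t × vAt Q (j + s) ≡ v)

  InSegE : Cycle → ℕ → ℕ → E → Set
  InSegE Q j t e = ∃[ s ] (s < t × eAt Q (j + s) ≡ e)

  IntersectionEmpty : ∀ {x y} → Path x y → Cycle → Set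
  IntersectionEmpty P Q = ∀ v → ¬ (v ∈Pv P × v ∈Cv Q)

  IntersectionShortSegment : ∀ {x y} → Path x y → Cycle → Set
  IntersectionShortSegment P Q =
    Σ ℕ λ j → Σ ℕ λ t →
      t < len Q × 2 * t ≤ len Q ×
      (∀ v → (v ∈Pv P × v ∈Cv Q) ⇔ InSegV Q j t v) ×
      (∀ e → (e ∈Pe P × e ∈Ce Q) ⇔ InSegE Q j t e)

  VertexDisjoint : Cycle → Cycle → Set
  VertexDisjoint Q R = ∀ v → ¬ (v ∈Cv Q × v ∈Cv R)

-- Induct on the number of cycles. Given a simple x–y walk W meeting each of the other cycles
-- in nothing or in a short segment, let a and b be its first and last vertex on the cycle C
-- and replace the stretch of W between them by the shorter of the two arcs of C from a to b.
-- The new walk is still simple and meets C exactly in that arc. A cycle D disjoint from C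
-- meets the new walk only in the kept part O of W. Since O and the discarded stretch share
-- only a and b, which lie on C, every edge of the old segment W ∩ D joins two vertices that
-- are both in O or both outside O; hence that segment lies wholly inside or wholly outside O,
-- and the new intersection with D is either the whole old segment or empty.
module Submission where

open import Defs
open import Level using (0ℓ)
open import Data.Nat using (ℕ; zero; suc; _+_; _*_; _∸_; _≤_; _<_; z≤n; s≤s; NonZero; _<?_)
open import Data.Nat.Properties
open import Data.Nat.DivMod
  using (_%_; _mod_; %-distribˡ-+; m%n%n≡m%n; m<n⇒m%n≡m; m%n<n; [m+n]%n≡m%n; m≤n⇒[n∸m]%m≡n%m)
open import Data.Fin using (Fin; toℕ; inject₁; fromℕ) renaming (zero to fzero; suc to fsuc)
import Data.Fin.Properties as Fin
open import Data.Product using (Σ; map; ∃-syntax; _×_; _,_; proj₁; proj₂)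
open import Data.Sum using (_⊎_; inj₁; inj₂; swap; map₂)
open import Data.Empty using (⊥; ⊥-elim)
open import Data.Unit using (⊤; tt)
open import Function using (_∘_; id)
open import Function.Definitions using (Injective)
open import Function.Bundles using (_⇔_; mk⇔; Equivalence)
open import Relation.Binary using (tri<; tri≈; tri>)
open import Relation.Binary.PropositionalEquality
  using (_≡_; _≢_; refl; sym; trans; cong; subst; module ≡-Reasoning)
open import Relation.Nullary using (yes; no; contradiction)
open import Relation.Nullary.Decidable using (_⊎-dec_)
open import Relation.Unary
  using (Pred; _∈_; _∉_; _∪_; _∩_; _⊆_; _≐_; ｛_｝; Empty; Decidable)

upto-induction : ∀ {p} (P : ℕ → Set p) {t} →
  (∀ {s} → s < t → P s → P (suc s)) → P 0 → ∀ {s} → s ≤ t → P s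
upto-induction P step p₀ {zero} _ = p₀
upto-induction P step p₀ {suc s} s<t = step s<t (upto-induction P step p₀ (<⇒≤ s<t))

[1+m%n]%n≡[1+m]%n : ∀ m n .{{_ : NonZero n}} → suc (m % n) % n ≡ suc m % n
[1+m%n]%n≡[1+m]%n m n = begin
  (1 + m % n) % n              ≡⟨ %-distribˡ-+ 1 (m % n) n ⟩
  (1 % n + m % n % n) % n      ≡⟨ cong (λ r → (1 % n + r) % n) (m%n%n≡m%n m n) ⟩
  (1 % n + m % n) % n          ≡⟨ %-distribˡ-+ 1 m n ⟨
  suc m % n                    ∎
  where open ≡-Reasoning

[r+d]%n≢r : ∀ n .{{_ : NonZero n}} {r d} → r < n → 0 < d → d < n → (r + d) % n ≢ r
[r+d]%n≢r n {r} {d} r<n 0<d d<n eq with r + d <? n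
... | yes r+d<n = <⇒≢ (m<m+n r 0<d) (sym (trans (sym (m<n⇒m%n≡m r+d<n)) eq))
... | no r+d≮n = <⇒≢ d<n (+-cancelˡ-≡ r d n (begin
    r + d            ≡⟨ m∸n+n≡m n≤r+d ⟨
    r + d ∸ n + n    ≡⟨ cong (_+ n) wrapped ⟩
    r + n            ∎))
  where
  open ≡-Reasoning
  n≤r+d = ≮⇒≥ r+d≮n
  r+d∸n<n : r + d ∸ n < n
  r+d∸n<n = subst (r + d ∸ n <_) (m+n∸n≡m n n) (∸-monoˡ-< (+-mono-< r<n d<n) n≤r+d)
  wrapped : r + d ∸ n ≡ r
  wrapped = begin
    r + d ∸ n        ≡⟨ m<n⇒m%n≡m r+d∸n<n ⟨
    (r + d ∸ n) % n  ≡⟨ m≤n⇒[n∸m]%m≡n%m n≤r+d ⟩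
    (r + d) % n      ≡⟨ eq ⟩
    r                ∎

[m+d]%n≢m%n : ∀ n .{{_ : NonZero n}} m {d} → 0 < d → d < n → (m + d) % n ≢ m % n
[m+d]%n≢m%n n m {d} 0<d d<n eq = [r+d]%n≢r n (m%n<n m n) 0<d d<n (begin
  (m % n + d) % n      ≡⟨ cong (λ d′ → (m % n + d′) % n) (m<n⇒m%n≡m d<n) ⟨
  (m % n + d % n) % n  ≡⟨ %-distribˡ-+ m d n ⟨
  (m + d) % n          ≡⟨ eq ⟩
  m % n                ∎)
  where open ≡-Reasoning

[m+s]%n≢[m+s′]%n : ∀ n .{{_ : NonZero n}} m {s s′} → s < s′ → s′ < n →
  (m + s) % n ≢ (m + s′) % n
[m+s]%n≢[m+s′]%n n m {s} {s′} s<s′ s′<n eq =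
  [m+d]%n≢m%n n (m + s) (m<n⇒0<n∸m s<s′) (≤-<-trans (m∸n≤m s′ s) s′<n) (begin
    (m + s + (s′ ∸ s)) % n   ≡⟨ cong (_% n) (+-assoc m s (s′ ∸ s)) ⟩
    (m + (s + (s′ ∸ s))) % n ≡⟨ cong (λ k → (m + k) % n) (m+[n∸m]≡n (<⇒≤ s<s′)) ⟩
    (m + s′) % n             ≡⟨ eq ⟨
    (m + s) % n              ∎)
  where open ≡-Reasoning

[m+s]%n-injective : ∀ n .{{_ : NonZero n}} m {s s′} → s < n → s′ < n →
  (m + s) % n ≡ (m + s′) % n → s ≡ s′
[m+s]%n-injective n m {s} {s′} s<n s′<n eq with <-cmp s s′
... | tri< s<s′ _ _ = contradiction eq ([m+s]%n≢[m+s′]%n n m s<s′ s′<n)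
... | tri≈ _ s≡s′ _ = s≡s′
... | tri> _ _ s′<s = contradiction (sym eq) ([m+s]%n≢[m+s′]%n n m s′<s s<n)

half<whole : ∀ {t L} → 0 < L → 2 * t ≤ L → t < L
half<whole {zero} 0<L _ = 0<L
half<whole {suc t} _ 2t≤L = <-≤-trans (m<m+n (suc t) (s≤s z≤n)) 2t≤L

shorter-arc : ∀ {I J L} → I ≤ J → J ≤ I + L →
  (∃[ t ] I + t ≡ J × 2 * t ≤ L) ⊎ (∃[ t ] J + t ≡ I + L × 2 * t ≤ L)
shorter-arc {I} {J} {L} I≤J J≤I+L = pick (≤-total d r)
  where
  d = J ∸ I
  r = I + L ∸ J
  double≤ : ∀ {t u} → t ≤ u → 2 * t ≤ t + u
  double≤ {t} t≤u = +-monoʳ-≤ t (subst (_≤ _) (sym (+-identityʳ t)) t≤u)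
  d+r≡L : d + r ≡ L
  d+r≡L = +-cancelˡ-≡ I _ _ (begin
    I + (d + r)  ≡⟨ +-assoc I d r ⟨
    I + d + r    ≡⟨ cong (_+ r) (m+[n∸m]≡n I≤J) ⟩
    J + r        ≡⟨ m+[n∸m]≡n J≤I+L ⟩
    I + L        ∎)
    where open ≡-Reasoning
  pick : d ≤ r ⊎ r ≤ d →
    (∃[ t ] I + t ≡ J × 2 * t ≤ L) ⊎ (∃[ t ] J + t ≡ I + L × 2 * t ≤ L)
  pick (inj₁ d≤r) = inj₁ (d , m+[n∸m]≡n I≤J , subst (2 * d ≤_) d+r≡L (double≤ d≤r))
  pick (inj₂ r≤d) = inj₂ (r , m+[n∸m]≡n J≤I+L ,
    subst (2 * r ≤_) (trans (+-comm r d) d+r≡L) (double≤ r≤d))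

Image≤ : ∀ {A : Set} → (ℕ → A) → ℕ → Pred A 0ℓ
Image≤ f t a = ∃[ s ] (s ≤ t × f s ≡ a)

Image< : ∀ {A : Set} → (ℕ → A) → ℕ → Pred A 0ℓ
Image< f t a = ∃[ s ] (s < t × f s ≡ a)

InjectiveUpTo : ∀ {A : Set} → (ℕ → A) → ℕ → Set
InjectiveUpTo f t = ∀ {s s′} → s ≤ t → s′ ≤ t → f s ≡ f s′ → s ≡ s′

module WalksIn (H : Multigraph) where
  open Multigraph H

  private variable
    x y z a b v : V
    e : E

  verts : Walk x y → Pred V 0ℓ
  verts {x} [] v = v ≡ x
  verts {x} (step _ _ w) v = v ≡ x ⊎ v ∈ verts w

  edges : Walk x y → Pred E 0ℓ
  edges [] _ = ⊥
  edges (step e _ w) f = f ≡ e ⊎ f ∈ edges w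

  Simple : Walk x y → Set
  Simple [] = ⊤
  Simple {x} (step _ _ w) = x ∉ verts w × Simple w

  _++_ : Walk x y → Walk y z → Walk x z
  [] ++ w′ = w′
  step e j w ++ w′ = step e j (w ++ w′)

  start∈verts : (w : Walk x y) → x ∈ verts w
  start∈verts [] = refl
  start∈verts (step _ _ _) = inj₁ refl

  end∈verts : (w : Walk x y) → y ∈ verts w
  end∈verts [] = refl
  end∈verts (step _ _ w) = inj₂ (end∈verts w)

  verts? : (w : Walk x y) → Decidable (verts w)
  verts? [] v = v Fin.≟ _
  verts? (step _ _ w) v = (v Fin.≟ _) ⊎-dec verts? w v

  verts-++⁻ : (w : Walk x y) (w′ : Walk y z) → verts (w ++ w′) ⊆ verts w ∪ verts w′
  verts-++⁻ [] w′ p = inj₂ p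
  verts-++⁻ (step _ _ w) w′ (inj₁ p) = inj₁ (inj₁ p)
  verts-++⁻ (step _ _ w) w′ (inj₂ p) with verts-++⁻ w w′ p
  ... | inj₁ q = inj₁ (inj₂ q)
  ... | inj₂ q = inj₂ q

  verts-++⁺ˡ : (w : Walk x y) (w′ : Walk y z) → verts w ⊆ verts (w ++ w′)
  verts-++⁺ˡ [] w′ refl = start∈verts w′
  verts-++⁺ˡ (step _ _ w) w′ (inj₁ p) = inj₁ p
  verts-++⁺ˡ (step _ _ w) w′ (inj₂ p) = inj₂ (verts-++⁺ˡ w w′ p)

  verts-++⁺ʳ : (w : Walk x y) (w′ : Walk y z) → verts w′ ⊆ verts (w ++ w′)
  verts-++⁺ʳ [] w′ p = p
  verts-++⁺ʳ (step _ _ w) w′ p = inj₂ (verts-++⁺ʳ w w′ p)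

  edges-++⁻ : (w : Walk x y) (w′ : Walk y z) → edges (w ++ w′) ⊆ edges w ∪ edges w′
  edges-++⁻ [] w′ p = inj₂ p
  edges-++⁻ (step _ _ w) w′ (inj₁ p) = inj₁ (inj₁ p)
  edges-++⁻ (step _ _ w) w′ (inj₂ p) with edges-++⁻ w w′ p
  ... | inj₁ q = inj₁ (inj₂ q)
  ... | inj₂ q = inj₂ q

  edges-++⁺ˡ : (w : Walk x y) (w′ : Walk y z) → edges w ⊆ edges (w ++ w′)
  edges-++⁺ˡ (step _ _ w) w′ (inj₁ p) = inj₁ p
  edges-++⁺ˡ (step _ _ w) w′ (inj₂ p) = inj₂ (edges-++⁺ˡ w w′ p)

  edges-++⁺ʳ : (w : Walk x y) (w′ : Walk y z) → edges w′ ⊆ edges (w ++ w′)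
  edges-++⁺ʳ [] w′ p = p
  edges-++⁺ʳ (step _ _ w) w′ p = inj₂ (edges-++⁺ʳ w w′ p)

  EndsIn : Pred E 0ℓ → Pred V 0ℓ → Set
  EndsIn ES VS = ∀ {e} → e ∈ ES → src e ∈ VS × tgt e ∈ VS

  joins-∈ : ∀ (P : Pred V 0ℓ) → Joins e x y → src e ∈ P × tgt e ∈ P → x ∈ P × y ∈ P
  joins-∈ P (inj₁ (refl , refl)) ends = ends
  joins-∈ P (inj₂ (refl , refl)) (s , t) = t , s

  edges-endsIn-verts : (w : Walk x y) → EndsIn (edges w) (verts w)
  edges-endsIn-verts (step _ (inj₁ (refl , refl)) w) (inj₁ refl) = inj₁ refl , inj₂ (start∈verts w)
  edges-endsIn-verts (step _ (inj₂ (refl , refl)) w) (inj₁ refl) = inj₂ (start∈verts w) , inj₁ refl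
  edges-endsIn-verts (step _ _ w) (inj₂ p) = map inj₂ inj₂ (edges-endsIn-verts w p)

  simple-++ : (w : Walk x y) (w′ : Walk y z) → Simple w → Simple w′ →
    verts w ∩ verts w′ ⊆ ｛ y ｝ → Simple (w ++ w′)
  simple-++ [] w′ _ simple′ _ = simple′
  simple-++ (step {x} _ _ w) w′ (x∉w , simple) simple′ meet =
    x∉w++w′ , simple-++ w w′ simple simple′ (λ (p , q) → meet (inj₂ p , q))
    where
    x∉w++w′ : x ∉ verts (w ++ w′)
    x∉w++w′ p with verts-++⁻ w w′ p
    ... | inj₁ q = x∉w q
    ... | inj₂ q with meet (inj₁ refl , q)
    ...   | refl = x∉w (end∈verts w)

  simple-++⁻ : (w : Walk x y) (w′ : Walk y z) → Simple (w ++ w′) →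
    Simple w × Simple w′ × verts w ∩ verts w′ ⊆ ｛ y ｝
  simple-++⁻ [] w′ simple = tt , simple , λ (p , _) → sym p
  simple-++⁻ {y = y} (step {x} e j w) w′ (x∉w++w′ , simple) with simple-++⁻ w w′ simple
  ... | simple-w , simple′ , meet = (x∉w++w′ ∘ verts-++⁺ˡ w w′ , simple-w) , simple′ , meet′
    where
    meet′ : verts (step e j w) ∩ verts w′ ⊆ ｛ y ｝
    meet′ (inj₁ refl , q) = ⊥-elim (x∉w++w′ (verts-++⁺ʳ w w′ q))
    meet′ (inj₂ p , q) = meet (p , q)

  suffixFrom : (w : Walk x y) → v ∈ verts w → Walk v y
  suffixFrom [] refl = []
  suffixFrom (step e j w) (inj₁ refl) = step e j w
  suffixFrom (step _ _ w) (inj₂ p) = suffixFrom w p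

  simple-suffixFrom : (w : Walk x y) (p : v ∈ verts w) → Simple w → Simple (suffixFrom w p)
  simple-suffixFrom [] refl _ = tt
  simple-suffixFrom (step _ _ w) (inj₁ refl) simple = simple
  simple-suffixFrom (step _ _ w) (inj₂ p) (_ , simple) = simple-suffixFrom w p simple

  simplify : Walk x y → Σ (Walk x y) Simple
  simplify [] = [] , tt
  simplify (step {x} e j w) with simplify w
  ... | w′ , simple with verts? w′ x
  ... | yes p = suffixFrom w′ p , simple-suffixFrom w′ p simple
  ... | no x∉w′ = step e j w′ , x∉w′ , simple

  module _ (w₁ : Walk x y) (w₂ : Walk y z) (w₃ : Walk z a) where

    verts-++₃⁻ : verts (w₁ ++ (w₂ ++ w₃)) ⊆ verts w₁ ∪ verts w₂ ∪ verts w₃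
    verts-++₃⁻ = map₂ (verts-++⁻ w₂ w₃) ∘ verts-++⁻ w₁ (w₂ ++ w₃)

    edges-++₃⁻ : edges (w₁ ++ (w₂ ++ w₃)) ⊆ edges w₁ ∪ edges w₂ ∪ edges w₃
    edges-++₃⁻ = map₂ (edges-++⁻ w₂ w₃) ∘ edges-++⁻ w₁ (w₂ ++ w₃)

    verts-++₃⁺ : verts w₁ ∪ verts w₂ ∪ verts w₃ ⊆ verts (w₁ ++ (w₂ ++ w₃))
    verts-++₃⁺ (inj₁ p) = verts-++⁺ˡ w₁ _ p
    verts-++₃⁺ (inj₂ (inj₁ p)) = verts-++⁺ʳ w₁ _ (verts-++⁺ˡ w₂ w₃ p)
    verts-++₃⁺ (inj₂ (inj₂ p)) = verts-++⁺ʳ w₁ _ (verts-++⁺ʳ w₂ w₃ p)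

    edges-++₃⁺ : edges w₁ ∪ edges w₂ ∪ edges w₃ ⊆ edges (w₁ ++ (w₂ ++ w₃))
    edges-++₃⁺ (inj₁ p) = edges-++⁺ˡ w₁ _ p
    edges-++₃⁺ (inj₂ (inj₁ p)) = edges-++⁺ʳ w₁ _ (edges-++⁺ˡ w₂ w₃ p)
    edges-++₃⁺ (inj₂ (inj₂ p)) = edges-++⁺ʳ w₁ _ (edges-++⁺ʳ w₂ w₃ p)

    outer-verts : verts w₁ ∪ verts w₃ ⊆ verts (w₁ ++ (w₂ ++ w₃))
    outer-verts (inj₁ p) = verts-++₃⁺ (inj₁ p)
    outer-verts (inj₂ p) = verts-++₃⁺ (inj₂ (inj₂ p))

    outer-edges : edges w₁ ∪ edges w₃ ⊆ edges (w₁ ++ (w₂ ++ w₃))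
    outer-edges (inj₁ p) = edges-++₃⁺ (inj₁ p)
    outer-edges (inj₂ p) = edges-++₃⁺ (inj₂ (inj₂ p))

    edges-++₃⊆outer∪inner : edges (w₁ ++ (w₂ ++ w₃)) ⊆ (edges w₁ ∪ edges w₃) ∪ edges w₂
    edges-++₃⊆outer∪inner p with edges-++₃⁻ p
    ... | inj₁ q = inj₁ (inj₁ q)
    ... | inj₂ (inj₁ q) = inj₂ q
    ... | inj₂ (inj₂ q) = inj₁ (inj₂ q)

    outer-edges-endsIn : EndsIn (edges w₁ ∪ edges w₃) (verts w₁ ∪ verts w₃)
    outer-edges-endsIn (inj₁ p) = map inj₁ inj₁ (edges-endsIn-verts w₁ p)
    outer-edges-endsIn (inj₂ p) = map inj₂ inj₂ (edges-endsIn-verts w₃ p)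

  Chain : (ℕ → V) → (ℕ → E) → Set
  Chain f g = ∀ s → Joins (g s) (f s) (f (suc s))

  forward : (f : ℕ → V) (g : ℕ → E) → Chain f g → (t : ℕ) → Walk (f 0) (f t)
  forward f g c zero = []
  forward f g c (suc t) = step (g 0) (c 0) (forward (f ∘ suc) (g ∘ suc) (c ∘ suc) t)

  verts-forward⁻ : ∀ f g (c : Chain f g) t → verts (forward f g c t) ⊆ Image≤ f t
  verts-forward⁻ f g c zero p = 0 , z≤n , sym p
  verts-forward⁻ f g c (suc t) (inj₁ p) = 0 , z≤n , sym p
  verts-forward⁻ f g c (suc t) (inj₂ p) with verts-forward⁻ (f ∘ suc) (g ∘ suc) (c ∘ suc) t p
  ... | s , s≤t , eq = suc s , s≤s s≤t , eq

  verts-forward⁺ : ∀ f g (c : Chain f g) t → Image≤ f t ⊆ verts (forward f g c t)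
  verts-forward⁺ f g c zero (zero , _ , refl) = refl
  verts-forward⁺ f g c (suc t) (zero , _ , refl) = inj₁ refl
  verts-forward⁺ f g c (suc t) (suc s , s≤s s≤t , refl) =
    inj₂ (verts-forward⁺ (f ∘ suc) (g ∘ suc) (c ∘ suc) t (s , s≤t , refl))

  edges-forward⁻ : ∀ f g (c : Chain f g) t → edges (forward f g c t) ⊆ Image< g t
  edges-forward⁻ f g c (suc t) (inj₁ p) = 0 , s≤s z≤n , sym p
  edges-forward⁻ f g c (suc t) (inj₂ p) with edges-forward⁻ (f ∘ suc) (g ∘ suc) (c ∘ suc) t p
  ... | s , s<t , eq = suc s , s≤s s<t , eq

  edges-forward⁺ : ∀ f g (c : Chain f g) t → Image< g t ⊆ edges (forward f g c t)
  edges-forward⁺ f g c (suc t) (zero , _ , refl) = inj₁ refl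
  edges-forward⁺ f g c (suc t) (suc s , s≤s s<t , refl) =
    inj₂ (edges-forward⁺ (f ∘ suc) (g ∘ suc) (c ∘ suc) t (s , s<t , refl))

  simple-forward : ∀ f g (c : Chain f g) t → InjectiveUpTo f t → Simple (forward f g c t)
  simple-forward f g c zero _ = tt
  simple-forward f g c (suc t) injective =
    head∉ , simple-forward (f ∘ suc) (g ∘ suc) (c ∘ suc) t
              (λ s≤t s′≤t → suc-injective ∘ injective (s≤s s≤t) (s≤s s′≤t))
    where
    head∉ : f 0 ∉ verts (forward (f ∘ suc) (g ∘ suc) (c ∘ suc) t)
    head∉ p with verts-forward⁻ (f ∘ suc) (g ∘ suc) (c ∘ suc) t p
    ... | s , s≤t , eq with injective (s≤s s≤t) z≤n eq
    ... | ()

  module _ (f : ℕ → V) (g : ℕ → E) (c : Chain f g) where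

    backward : (t : ℕ) → Walk (f t) (f 0)
    backward zero = []
    backward (suc t) = step (g t) (swap (c t)) (backward t)

    verts-backward⁻ : ∀ t → verts (backward t) ⊆ Image≤ f t
    verts-backward⁻ zero p = 0 , z≤n , sym p
    verts-backward⁻ (suc t) (inj₁ p) = suc t , ≤-refl , sym p
    verts-backward⁻ (suc t) (inj₂ p) with verts-backward⁻ t p
    ... | s , s≤t , eq = s , m≤n⇒m≤1+n s≤t , eq

    verts-backward⁺ : ∀ t → Image≤ f t ⊆ verts (backward t)
    verts-backward⁺ zero (zero , _ , refl) = refl
    verts-backward⁺ (suc t) (s , s≤1+t , refl) with m≤n⇒m<n∨m≡n s≤1+t
    ... | inj₁ (s≤s s≤t) = inj₂ (verts-backward⁺ t (s , s≤t , refl))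
    ... | inj₂ refl = inj₁ refl

    edges-backward⁻ : ∀ t → edges (backward t) ⊆ Image< g t
    edges-backward⁻ (suc t) (inj₁ p) = t , n<1+n t , sym p
    edges-backward⁻ (suc t) (inj₂ p) with edges-backward⁻ t p
    ... | s , s<t , eq = s , m<n⇒m<1+n s<t , eq

    edges-backward⁺ : ∀ t → Image< g t ⊆ edges (backward t)
    edges-backward⁺ (suc t) (s , s≤s s≤t , refl) with m≤n⇒m<n∨m≡n s≤t
    ... | inj₁ s<t = inj₂ (edges-backward⁺ t (s , s<t , refl))
    ... | inj₂ refl = inj₁ refl

    simple-backward : ∀ t → InjectiveUpTo f t → Simple (backward t)
    simple-backward zero _ = tt
    simple-backward (suc t) injective =
      last∉ , simple-backward t (λ s≤t s′≤t → injective (m≤n⇒m≤1+n s≤t) (m≤n⇒m≤1+n s′≤t))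
      where
      last∉ : f (suc t) ∉ verts (backward t)
      last∉ p with verts-backward⁻ t p
      ... | s , s≤t , eq with injective (m≤n⇒m≤1+n s≤t) ≤-refl eq
      ... | refl = 1+n≰n s≤t

  cycleVerts : Cycle → Pred V 0ℓ
  cycleVerts C v = v ∈Cv C

  cycleEdges : Cycle → Pred E 0ℓ
  cycleEdges C e = e ∈Ce C

  cycleVerts? : (C : Cycle) → Decidable (cycleVerts C)
  cycleVerts? C v = Fin.any? (λ i → vert C i Fin.≟ v)

  module _ (C : Cycle) where

    private
      %≡⇒mod≡ : ∀ m m′ → m % len C ≡ m′ % len C → m mod len C ≡ m′ mod len C
      %≡⇒mod≡ m m′ eq =
        Fin.toℕ-injective (trans (Fin.toℕ-fromℕ< _) (trans eq (sym (Fin.toℕ-fromℕ< _))))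

      mod≡⇒%≡ : ∀ m m′ → m mod len C ≡ m′ mod len C → m % len C ≡ m′ % len C
      mod≡⇒%≡ m m′ eq = trans (sym (Fin.toℕ-fromℕ< _)) (trans (cong toℕ eq) (Fin.toℕ-fromℕ< _))

    vAt∈cycle : ∀ m → vAt C m ∈ cycleVerts C
    vAt∈cycle m = m mod len C , refl

    eAt∈cycle : ∀ m → eAt C m ∈ cycleEdges C
    eAt∈cycle m = m mod len C , refl

    vAt-toℕ : ∀ i → vAt C (toℕ i) ≡ vert C i
    vAt-toℕ i = cong (vert C) (Fin.toℕ-injective
      (trans (Fin.toℕ-fromℕ< _) (m<n⇒m%n≡m (Fin.toℕ<n i))))

    vAt-+len : ∀ m → vAt C (m + len C) ≡ vAt C m
    vAt-+len m = cong (vert C) (%≡⇒mod≡ (m + len C) m ([m+n]%n≡m%n m (len C)))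

    eAt-joins : ∀ m → Joins (eAt C m) (vAt C m) (vAt C (suc m))
    eAt-joins m =
      subst (Joins (eAt C m) (vAt C m) ∘ vert C) (%≡⇒mod≡ (suc (toℕ (m mod len C))) (suc m) next≡)
            (edge-joins C (m mod len C))
      where
      next≡ : suc (toℕ (m mod len C)) % len C ≡ suc m % len C
      next≡ = trans (cong (λ r → suc r % len C) (Fin.toℕ-fromℕ< (m%n<n m (len C))))
                    ([1+m%n]%n≡[1+m]%n m (len C))

    arcChain : ∀ p → Chain (λ s → vAt C (p + s)) (λ s → eAt C (p + s))
    arcChain p s =
      subst (Joins (eAt C (p + s)) (vAt C (p + s)) ∘ vAt C) (sym (+-suc p s)) (eAt-joins (p + s))

    vAt-injectiveUpTo : ∀ p {t} → t < len C → InjectiveUpTo (λ s → vAt C (p + s)) t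
    vAt-injectiveUpTo p t<L s≤t s′≤t eq =
      [m+s]%n-injective (len C) p (≤-<-trans s≤t t<L) (≤-<-trans s′≤t t<L)
        (mod≡⇒%≡ (p + _) (p + _) (vert-inj C eq))

    cycleEdges-endsIn : EndsIn (cycleEdges C) (cycleVerts C)
    cycleEdges-endsIn (i , refl) with edge-joins C i
    ... | inj₁ (s≡ , t≡) = (i , sym s≡) , (_ , sym t≡)
    ... | inj₂ (s≡ , t≡) = (_ , sym s≡) , (i , sym t≡)

  record ShortArc (C : Cycle) (a b : V) : Set where
    field
      walk : Walk a b
      walk-simple : Simple walk
      origin span : ℕ
      2span≤len : 2 * span ≤ len C
      verts-walk : verts walk ≐ InSegV C origin span
      edges-walk : edges walk ≐ InSegE C origin span

  module _ (C : Cycle) where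

    private
      along : ℕ → ℕ → V
      along p s = vAt C (p + s)

      alongE : ℕ → ℕ → E
      alongE p s = eAt C (p + s)

      injective : ∀ p {t} → 2 * t ≤ len C → InjectiveUpTo (along p) t
      injective p 2t≤L = vAt-injectiveUpTo C p (half<whole (s≤s z≤n) 2t≤L)

    forwardArc : ∀ {a b} p t → 2 * t ≤ len C → along p 0 ≡ a → along p t ≡ b → ShortArc C a b
    forwardArc p t 2t≤L refl refl = record
      { walk = forward (along p) (alongE p) (arcChain C p) t
      ; walk-simple = simple-forward (along p) (alongE p) (arcChain C p) t (injective p 2t≤L)
      ; origin = p
      ; span = t
      ; 2span≤len = 2t≤L
      ; verts-walk = verts-forward⁻ (along p) (alongE p) (arcChain C p) t
                   , verts-forward⁺ (along p) (alongE p) (arcChain C p) t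
      ; edges-walk = edges-forward⁻ (along p) (alongE p) (arcChain C p) t
                   , edges-forward⁺ (along p) (alongE p) (arcChain C p) t
      }

    backwardArc : ∀ {a b} p t → 2 * t ≤ len C → along p t ≡ a → along p 0 ≡ b → ShortArc C a b
    backwardArc p t 2t≤L refl refl = record
      { walk = backward (along p) (alongE p) (arcChain C p) t
      ; walk-simple = simple-backward (along p) (alongE p) (arcChain C p) t (injective p 2t≤L)
      ; origin = p
      ; span = t
      ; 2span≤len = 2t≤L
      ; verts-walk = verts-backward⁻ (along p) (alongE p) (arcChain C p) t
                   , verts-backward⁺ (along p) (alongE p) (arcChain C p) t
      ; edges-walk = edges-backward⁻ (along p) (alongE p) (arcChain C p) t
                   , edges-backward⁺ (along p) (alongE p) (arcChain C p) t
      }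

    shortArcs≤ : ∀ {I J a b} → I ≤ J → J < len C → vAt C I ≡ a → vAt C J ≡ b →
      ShortArc C a b × ShortArc C b a
    shortArcs≤ {I} {J} I≤J J<L Ia Jb
      with shorter-arc I≤J (≤-trans (<⇒≤ J<L) (m≤n+m (len C) I))
    ... | inj₁ (t , I+t≡J , 2t≤L) =
      forwardArc I t 2t≤L I+0a I+tb , backwardArc I t 2t≤L I+tb I+0a
      where
      I+0a = trans (cong (vAt C) (+-identityʳ I)) Ia
      I+tb = trans (cong (vAt C) I+t≡J) Jb
    ... | inj₂ (t , J+t≡I+L , 2t≤L) =
      backwardArc J t 2t≤L J+ta J+0b , forwardArc J t 2t≤L J+0b J+ta
      where
      J+0b = trans (cong (vAt C) (+-identityʳ J)) Jb
      J+ta = trans (cong (vAt C) J+t≡I+L) (trans (vAt-+len C I) Ia)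

    shortArc : ∀ {a b} → a ∈ cycleVerts C → b ∈ cycleVerts C → ShortArc C a b
    shortArc (i , refl) (j , refl) with ≤-total (toℕ i) (toℕ j)
    ... | inj₁ i≤j = proj₁ (shortArcs≤ i≤j (Fin.toℕ<n j) (vAt-toℕ C i) (vAt-toℕ C j))
    ... | inj₂ j≤i = proj₂ (shortArcs≤ j≤i (Fin.toℕ<n i) (vAt-toℕ C j) (vAt-toℕ C i))

  -- IntersectionEmpty and IntersectionShortSegment of Defs, for arbitrary vertex and edge sets.
  Avoids : Pred V 0ℓ → Cycle → Set
  Avoids VS C = Empty (VS ∩ cycleVerts C)

  MeetsInShortSegment : Pred V 0ℓ → Pred E 0ℓ → Cycle → Set
  MeetsInShortSegment VS ES C = Σ ℕ λ j → Σ ℕ λ t →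
    t < len C × 2 * t ≤ len C ×
    (∀ v → v ∈ VS ∩ cycleVerts C ⇔ InSegV C j t v) ×
    (∀ e → e ∈ ES ∩ cycleEdges C ⇔ InSegE C j t e)

  Tame : Pred V 0ℓ → Pred E 0ℓ → Cycle → Set
  Tame VS ES C = Avoids VS C ⊎ MeetsInShortSegment VS ES C

  private
    ∩-transfer : ∀ {A : Set} {P P′ Q R : Pred A 0ℓ} →
      (∀ {x} → x ∈ Q → x ∈ P ⇔ x ∈ P′) → (∀ x → x ∈ P ∩ Q ⇔ R x) → ∀ x → x ∈ P′ ∩ Q ⇔ R x
    ∩-transfer P⇔P′ P∩Q⇔R x = mk⇔
      (λ (p′ , q) → Equivalence.to (P∩Q⇔R x) (Equivalence.from (P⇔P′ q) p′ , q))
      (λ r → let (p , q) = Equivalence.from (P∩Q⇔R x) r in Equivalence.to (P⇔P′ q) p , q)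

  Tame-cong : ∀ C {VS VS′ ES ES′} →
    (∀ {v} → v ∈ cycleVerts C → v ∈ VS ⇔ v ∈ VS′) →
    (∀ {e} → e ∈ cycleEdges C → e ∈ ES ⇔ e ∈ ES′) →
    Tame VS ES C → Tame VS′ ES′ C
  Tame-cong C V⇔ E⇔ (inj₁ avoids) =
    inj₁ λ v (p′ , c) → avoids v (Equivalence.from (V⇔ c) p′ , c)
  Tame-cong C V⇔ E⇔ (inj₂ (j , t , t<L , 2t≤L , onV , onE)) =
    inj₂ (j , t , t<L , 2t≤L , ∩-transfer V⇔ onV , ∩-transfer E⇔ onE)

  module _ (D : Cycle) {O M : Pred V 0ℓ} {OE ME : Pred E 0ℓ}
           (OE-ends : EndsIn OE O) (ME-ends : EndsIn ME M)
           (disjoint : Empty (O ∩ M ∩ cycleVerts D)) where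

    private
      M-vertex∉O : ∀ {v} → v ∈ M → v ∈ cycleVerts D → v ∉ O
      M-vertex∉O m d o = disjoint _ (o , m , d)

    -- Membership in O can only change along an edge of ME, but neither end of such an edge
    -- on D lies in O.
    segment-inside-or-outside : Decidable O → ∀ j t →
      (∀ {s} → s < t → eAt D (j + s) ∈ OE ∪ ME) →
      (∀ {s} → s ≤ t → vAt D (j + s) ∈ O) ⊎ (∀ {s} → s ≤ t → vAt D (j + s) ∉ O)
    segment-inside-or-outside O? j t segment-edge with O? (vAt D (j + 0))
    ... | yes o₀ = inj₁ (upto-induction (λ s → vAt D (j + s) ∈ O) stays-in o₀)
      where
      stays-in : ∀ {s} → s < t → vAt D (j + s) ∈ O → vAt D (j + suc s) ∈ O
      stays-in {s} s<t o with segment-edge s<t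
      ... | inj₁ oe = proj₂ (joins-∈ O (arcChain D j s) (OE-ends oe))
      ... | inj₂ me = ⊥-elim (M-vertex∉O (proj₁ (joins-∈ M (arcChain D j s) (ME-ends me)))
                                          (vAt∈cycle D (j + s)) o)
    ... | no o₀∉ = inj₂ (upto-induction (λ s → vAt D (j + s) ∉ O) stays-out o₀∉)
      where
      stays-out : ∀ {s} → s < t → vAt D (j + s) ∉ O → vAt D (j + suc s) ∉ O
      stays-out {s} s<t o∉ with segment-edge s<t
      ... | inj₁ oe = ⊥-elim (o∉ (proj₁ (joins-∈ O (arcChain D j s) (OE-ends oe))))
      ... | inj₂ me = M-vertex∉O (proj₂ (joins-∈ M (arcChain D j s) (ME-ends me)))
                                 (vAt∈cycle D (j + suc s))

    tame-discard : ∀ {VS ES} → Decidable O → O ⊆ VS → OE ⊆ ES → ES ⊆ OE ∪ ME →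
      Tame VS ES D → Tame O OE D
    tame-discard O? O⊆VS OE⊆ES ES⊆ (inj₁ avoids) = inj₁ λ v (o , d) → avoids v (O⊆VS o , d)
    tame-discard O? O⊆VS OE⊆ES ES⊆ (inj₂ (j , t , t<L , 2t≤L , onV , onE)) =
      by-position (segment-inside-or-outside O? j t segment-edge)
      where
      segment-edge : ∀ {s} → s < t → eAt D (j + s) ∈ OE ∪ ME
      segment-edge s<t = ES⊆ (proj₁ (Equivalence.from (onE _) (_ , s<t , refl)))

      segment-edge∈OE : (∀ {s} → s ≤ t → vAt D (j + s) ∈ O) →
        ∀ {s} → s < t → eAt D (j + s) ∈ OE
      segment-edge∈OE inside {s} s<t with segment-edge s<t
      ... | inj₁ oe = oe
      ... | inj₂ me = ⊥-elim (M-vertex∉O (proj₁ (joins-∈ M (arcChain D j s) (ME-ends me)))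
                                          (vAt∈cycle D (j + s)) (inside (<⇒≤ s<t)))

      by-position : (∀ {s} → s ≤ t → vAt D (j + s) ∈ O) ⊎ (∀ {s} → s ≤ t → vAt D (j + s) ∉ O) →
        Tame O OE D
      by-position (inj₁ inside) = inj₂ (j , t , t<L , 2t≤L ,
        (λ v → mk⇔ (λ (o , d) → Equivalence.to (onV v) (O⊆VS o , d))
                   (λ { (s , s≤t , refl) → inside s≤t , vAt∈cycle D (j + s) })) ,
        (λ e → mk⇔ (λ (oe , d) → Equivalence.to (onE e) (OE⊆ES oe , d))
                   (λ { (s , s<t , refl) → segment-edge∈OE inside s<t , eAt∈cycle D (j + s) })))
      by-position (inj₂ outside) =
        inj₁ λ v (o , d) → off-segment o (Equivalence.to (onV v) (O⊆VS o , d))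
        where
        off-segment : ∀ {v} → v ∈ O → InSegV D j t v → ⊥
        off-segment o (s , s≤t , refl) = outside s≤t o

  meets-once⇒no-cycle-edge : ∀ C (w : Walk x y) → verts w ∩ cycleVerts C ⊆ ｛ a ｝ →
    Empty (edges w ∩ cycleEdges C)
  meets-once⇒no-cycle-edge C w once e (p , c)
    with edges-endsIn-verts w p | cycleEdges-endsIn C c
  ... | src∈w , tgt∈w | src∈C , tgt∈C =
    loopless e (trans (sym (once (src∈w , src∈C))) (once (tgt∈w , tgt∈C)))

  record FirstHit (S : Pred V 0ℓ) (w : Walk x y) : Set where
    field
      hit : V
      hit∈S : hit ∈ S
      before : Walk x hit
      after : Walk hit y
      split : w ≡ before ++ after
      before-hits-once : verts before ∩ S ⊆ ｛ hit ｝

  record LastHit (S : Pred V 0ℓ) (w : Walk x y) : Set where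
    field
      hit : V
      hit∈S : hit ∈ S
      before : Walk x hit
      after : Walk hit y
      split : w ≡ before ++ after
      after-hits-once : verts after ∩ S ⊆ ｛ hit ｝

  module _ {S : Pred V 0ℓ} (S? : Decidable S) where

    first-hit : (w : Walk x y) → Empty (verts w ∩ S) ⊎ FirstHit S w
    first-hit ([] {x}) with S? x
    ... | yes x∈S = inj₂ record
      { hit = x ; hit∈S = x∈S ; before = [] ; after = [] ; split = refl
      ; before-hits-once = λ (v≡x , _) → sym v≡x }
    ... | no x∉S = inj₁ λ { _ (refl , x∈S) → x∉S x∈S }
    first-hit (step {x} e j w) with S? x
    ... | yes x∈S = inj₂ record
      { hit = x ; hit∈S = x∈S ; before = [] ; after = step e j w ; split = refl
      ; before-hits-once = λ (v≡x , _) → sym v≡x }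
    ... | no x∉S with first-hit w
    ...   | inj₁ avoids =
      inj₁ λ { _ (inj₁ refl , x∈S) → x∉S x∈S ; v (inj₂ p , v∈S) → avoids v (p , v∈S) }
    ...   | inj₂ h = inj₂ record
      { hit = hit ; hit∈S = hit∈S ; before = step e j before ; after = after
      ; split = cong (step e j) split
      ; before-hits-once = λ { (inj₁ refl , x∈S) → ⊥-elim (x∉S x∈S)
                             ; (inj₂ p , v∈S) → before-hits-once (p , v∈S) } }
      where open FirstHit h

    last-hit : (w : Walk x y) → Empty (verts w ∩ S) ⊎ LastHit S w
    last-hit ([] {x}) with S? x
    ... | yes x∈S = inj₂ record
      { hit = x ; hit∈S = x∈S ; before = [] ; after = [] ; split = refl
      ; after-hits-once = λ (v≡x , _) → sym v≡x }
    ... | no x∉S = inj₁ λ { _ (refl , x∈S) → x∉S x∈S }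
    last-hit (step {x} e j w) with last-hit w
    ... | inj₂ h = inj₂ record
      { hit = hit ; hit∈S = hit∈S ; before = step e j before ; after = after
      ; split = cong (step e j) split ; after-hits-once = after-hits-once }
      where open LastHit h
    ... | inj₁ avoids with S? x
    ...   | yes x∈S = inj₂ record
      { hit = x ; hit∈S = x∈S ; before = [] ; after = step e j w ; split = refl
      ; after-hits-once = λ { (inj₁ v≡x , _) → sym v≡x
                            ; (inj₂ p , v∈S) → ⊥-elim (avoids _ (p , v∈S)) } }
    ...   | no x∉S =
      inj₁ λ { _ (inj₁ refl , x∈S) → x∉S x∈S ; v (inj₂ p , v∈S) → avoids v (p , v∈S) }

  module Reroute (C : Cycle) {x a b y : V} (pre : Walk x a) (mid : Walk a b) (post : Walk b y)
    (a∈C : a ∈ cycleVerts C) (b∈C : b ∈ cycleVerts C)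
    (pre-hits-once : verts pre ∩ cycleVerts C ⊆ ｛ a ｝)
    (post-hits-once : verts post ∩ cycleVerts C ⊆ ｛ b ｝)
    (simple : Simple (pre ++ (mid ++ post))) where

    open ShortArc (shortArc C a∈C b∈C)

    rerouted : Walk x y
    rerouted = pre ++ (walk ++ post)

    private
      walk⊆C : verts walk ⊆ cycleVerts C
      walk⊆C p with proj₁ verts-walk p
      ... | s , _ , refl = vAt∈cycle C (origin + s)

      simple-pre : Simple pre
      simple-pre = proj₁ (simple-++⁻ pre (mid ++ post) simple)

      simple-rest : Simple (mid ++ post)
      simple-rest = proj₁ (proj₂ (simple-++⁻ pre (mid ++ post) simple))

      pre-meets-rest : verts pre ∩ verts (mid ++ post) ⊆ ｛ a ｝
      pre-meets-rest = proj₂ (proj₂ (simple-++⁻ pre (mid ++ post) simple))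

      simple-post : Simple post
      simple-post = proj₁ (proj₂ (simple-++⁻ mid post simple-rest))

      mid-meets-post : verts mid ∩ verts post ⊆ ｛ b ｝
      mid-meets-post = proj₂ (proj₂ (simple-++⁻ mid post simple-rest))

    rerouted-simple : Simple rerouted
    rerouted-simple = simple-++ pre (walk ++ post) simple-pre
        (simple-++ walk post walk-simple simple-post (λ (p , q) → post-hits-once (q , walk⊆C p)))
        pre-meets-walk++post
      where
      pre-meets-walk++post : verts pre ∩ verts (walk ++ post) ⊆ ｛ a ｝
      pre-meets-walk++post (p , q) with verts-++⁻ walk post q
      ... | inj₁ r = pre-hits-once (p , walk⊆C r)
      ... | inj₂ r = pre-meets-rest (p , verts-++⁺ʳ mid post r)

    rerouted-meets-C : MeetsInShortSegment (verts rerouted) (edges rerouted) C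
    rerouted-meets-C = origin , span , half<whole (s≤s z≤n) 2span≤len , 2span≤len ,
        (λ v → mk⇔ vertex-on-segment segment-vertex) ,
        (λ e → mk⇔ edge-on-segment segment-edge)
      where
      vertex-on-segment : verts rerouted ∩ cycleVerts C ⊆ InSegV C origin span
      vertex-on-segment (p , c) with verts-++₃⁻ pre walk post p
      ... | inj₂ (inj₁ q) = proj₁ verts-walk q
      ... | inj₁ q with pre-hits-once (q , c)
      ...   | refl = proj₁ verts-walk (start∈verts walk)
      vertex-on-segment (p , c) | inj₂ (inj₂ q) with post-hits-once (q , c)
      ...   | refl = proj₁ verts-walk (end∈verts walk)

      segment-vertex : InSegV C origin span ⊆ verts rerouted ∩ cycleVerts C
      segment-vertex q =
        verts-++₃⁺ pre walk post (inj₂ (inj₁ (proj₂ verts-walk q))) , walk⊆C (proj₂ verts-walk q)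

      edge-on-segment : edges rerouted ∩ cycleEdges C ⊆ InSegE C origin span
      edge-on-segment (p , c) with edges-++₃⁻ pre walk post p
      ... | inj₁ q = ⊥-elim (meets-once⇒no-cycle-edge C pre pre-hits-once _ (q , c))
      ... | inj₂ (inj₁ q) = proj₁ edges-walk q
      ... | inj₂ (inj₂ q) = ⊥-elim (meets-once⇒no-cycle-edge C post post-hits-once _ (q , c))

      segment-edge : InSegE C origin span ⊆ edges rerouted ∩ cycleEdges C
      segment-edge q@(s , _ , refl) =
        edges-++₃⁺ pre walk post (inj₂ (inj₁ (proj₂ edges-walk q))) , eAt∈cycle C (origin + s)

    rerouted-preserves : ∀ D → VertexDisjoint C D →
      Tame (verts (pre ++ (mid ++ post))) (edges (pre ++ (mid ++ post))) D →
      Tame (verts rerouted) (edges rerouted) D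
    rerouted-preserves D disjoint tame =
      Tame-cong D outer⇔rerouted outerE⇔rerouted
        (tame-discard D (outer-edges-endsIn pre mid post) (edges-endsIn-verts mid) outer∩mid∩D=∅
          (λ v → verts? pre v ⊎-dec verts? post v)
          (outer-verts pre mid post) (outer-edges pre mid post)
          (edges-++₃⊆outer∪inner pre mid post) tame)
      where
      outer∩mid∩D=∅ : Empty ((verts pre ∪ verts post) ∩ verts mid ∩ cycleVerts D)
      outer∩mid∩D=∅ v (inj₁ p , m , d) with pre-meets-rest (p , verts-++⁺ˡ mid post m)
      ... | refl = disjoint a (a∈C , d)
      outer∩mid∩D=∅ v (inj₂ q , m , d) with mid-meets-post (m , q)
      ... | refl = disjoint b (b∈C , d)

      outer⇔rerouted : ∀ {v} → v ∈ cycleVerts D →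
        v ∈ verts pre ∪ verts post ⇔ v ∈ verts rerouted
      outer⇔rerouted {v} d = mk⇔ (outer-verts pre walk post) from
        where
        from : v ∈ verts rerouted → v ∈ verts pre ∪ verts post
        from p with verts-++₃⁻ pre walk post p
        ... | inj₁ q = inj₁ q
        ... | inj₂ (inj₁ q) = ⊥-elim (disjoint v (walk⊆C q , d))
        ... | inj₂ (inj₂ q) = inj₂ q

      outerE⇔rerouted : ∀ {e} → e ∈ cycleEdges D →
        e ∈ edges pre ∪ edges post ⇔ e ∈ edges rerouted
      outerE⇔rerouted {e} d = mk⇔ (outer-edges pre walk post) from
        where
        from : e ∈ edges rerouted → e ∈ edges pre ∪ edges post
        from p with edges-++₃⁻ pre walk post p
        ... | inj₁ q = inj₁ q
        ... | inj₂ (inj₁ q) = ⊥-elim (disjoint (src e)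
          (walk⊆C (proj₁ (edges-endsIn-verts walk q)) , proj₁ (cycleEdges-endsIn D d)))
        ... | inj₂ (inj₂ q) = inj₂ q

  reroute : (C : Cycle) (w : Walk x y) → Simple w →
    Σ (Walk x y) λ w′ → Simple w′ × Tame (verts w′) (edges w′) C ×
      (∀ D → VertexDisjoint C D → Tame (verts w) (edges w) D → Tame (verts w′) (edges w′) D)
  reroute C w simple with first-hit (cycleVerts? C) w
  ... | inj₁ avoids = w , simple , inj₁ avoids , λ _ _ tame → tame
  ... | inj₂ first with last-hit (cycleVerts? C) (FirstHit.after first)
  ...   | inj₁ avoids = ⊥-elim (avoids _ (start∈verts _ , FirstHit.hit∈S first))
  ...   | inj₂ last =
    rerouted , rerouted-simple , inj₂ rerouted-meets-C ,
    λ D disjoint → rerouted-preserves D disjoint ∘ subst (λ w → Tame (verts w) (edges w) D) w≡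
    where
    module F = FirstHit first
    module L = LastHit last
    w≡ : w ≡ F.before ++ (L.before ++ L.after)
    w≡ = trans F.split (cong (F.before ++_) L.split)
    open Reroute C F.before L.before L.after F.hit∈S L.hit∈S
                 F.before-hits-once L.after-hits-once (subst Simple w≡ simple)

  tame-simple-walk : Connected → (h : ℕ) (Q : Fin h → Cycle) →
    (∀ i j → i ≢ j → VertexDisjoint (Q i) (Q j)) →
    ∀ x y → Σ (Walk x y) λ w → Simple w × ∀ i → Tame (verts w) (edges w) (Q i)
  tame-simple-walk connected zero Q _ x y =
    let (w , simple) = simplify (connected x y) in w , simple , λ ()
  tame-simple-walk connected (suc h) Q disjoint x y
    with tame-simple-walk connected h (Q ∘ fsuc)
           (λ i j i≢j → disjoint (fsuc i) (fsuc j) (i≢j ∘ Fin.suc-injective)) x y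
  ... | w , simple , tame with reroute (Q fzero) w simple
  ...   | w′ , simple′ , tame₀ , keeps = w′ , simple′ , tame′
    where
    tame′ : ∀ i → Tame (verts w′) (edges w′) (Q i)
    tame′ fzero = tame₀
    tame′ (fsuc i) = keeps (Q (fsuc i)) (disjoint fzero (fsuc i) λ ()) (tame i)

  length : Walk x y → ℕ
  length [] = 0
  length (step _ _ w) = suc (length w)

  vertexAt : (w : Walk x y) → Fin (suc (length w)) → V
  vertexAt {x} _ fzero = x
  vertexAt [] (fsuc ())
  vertexAt (step _ _ w) (fsuc i) = vertexAt w i

  edgeAt : (w : Walk x y) → Fin (length w) → E
  edgeAt (step e _ _) fzero = e
  edgeAt (step _ _ w) (fsuc i) = edgeAt w i

  vertexAt∈verts : (w : Walk x y) → ∀ i → vertexAt w i ∈ verts w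
  vertexAt∈verts w fzero = start∈verts w
  vertexAt∈verts (step _ _ w) (fsuc i) = inj₂ (vertexAt∈verts w i)

  verts⇒vertexAt : (w : Walk x y) → v ∈ verts w → ∃[ i ] vertexAt w i ≡ v
  verts⇒vertexAt [] p = fzero , sym p
  verts⇒vertexAt (step _ _ w) (inj₁ p) = fzero , sym p
  verts⇒vertexAt (step _ _ w) (inj₂ p) = map fsuc id (verts⇒vertexAt w p)

  edgeAt∈edges : (w : Walk x y) → ∀ i → edgeAt w i ∈ edges w
  edgeAt∈edges (step _ _ w) fzero = inj₁ refl
  edgeAt∈edges (step _ _ w) (fsuc i) = inj₂ (edgeAt∈edges w i)

  edges⇒edgeAt : (w : Walk x y) → e ∈ edges w → ∃[ i ] edgeAt w i ≡ e
  edges⇒edgeAt (step _ _ w) (inj₁ p) = fzero , sym p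
  edges⇒edgeAt (step _ _ w) (inj₂ p) = map fsuc id (edges⇒edgeAt w p)

  vertexAt-injective : (w : Walk x y) → Simple w → Injective _≡_ _≡_ (vertexAt w)
  vertexAt-injective w _ {fzero} {fzero} _ = refl
  vertexAt-injective (step _ _ w) (x∉w , _) {fzero} {fsuc j} eq =
    ⊥-elim (x∉w (subst (_∈ verts w) (sym eq) (vertexAt∈verts w j)))
  vertexAt-injective (step _ _ w) (x∉w , _) {fsuc i} {fzero} eq =
    ⊥-elim (x∉w (subst (_∈ verts w) eq (vertexAt∈verts w i)))
  vertexAt-injective (step _ _ w) (_ , simple) {fsuc i} {fsuc j} eq =
    cong fsuc (vertexAt-injective w simple eq)

  edgeAt-joins : (w : Walk x y) →
    ∀ i → Joins (edgeAt w i) (vertexAt w (inject₁ i)) (vertexAt w (fsuc i))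
  edgeAt-joins (step _ j w) fzero = j
  edgeAt-joins (step _ _ w) (fsuc i) = edgeAt-joins w i

  vertexAt-last : (w : Walk x y) → vertexAt w (fromℕ (length w)) ≡ y
  vertexAt-last [] = refl
  vertexAt-last (step _ _ w) = vertexAt-last w

  toPath : (w : Walk x y) → Simple w → Path x y
  toPath w simple = record
    { k = length w
    ; vert = vertexAt w
    ; vert-inj = vertexAt-injective w simple
    ; edge = edgeAt w
    ; edge-joins = edgeAt-joins w
    ; start = refl
    ; end = vertexAt-last w
    }

  toPath-tame : (w : Walk x y) (simple : Simple w) (C : Cycle) → Tame (verts w) (edges w) C →
    IntersectionEmpty (toPath w simple) C ⊎ IntersectionShortSegment (toPath w simple) C
  toPath-tame w simple C = Tame-cong C
    (λ _ → mk⇔ (verts⇒vertexAt w) (λ { (i , refl) → vertexAt∈verts w i }))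
    (λ _ → mk⇔ (edges⇒edgeAt w) (λ { (i , refl) → edgeAt∈edges w i }))

lemma3p6 : (H : Multigraph) → Multigraph.Connected H →
    (h : ℕ) (Q : Fin h → Multigraph.Cycle H) →
    (∀ i j → i ≢ j → Multigraph.VertexDisjoint H (Q i) (Q j)) →
    ∀ (x y : Multigraph.V H) →
    Σ (Multigraph.Path H x y) λ P →
      ∀ i → Multigraph.IntersectionEmpty H P (Q i)
            ⊎ Multigraph.IntersectionShortSegment H P (Q i)
lemma3p6 H connected h Q disjoint x y
  with WalksIn.tame-simple-walk H connected h Q disjoint x y
... | w , simple , tame =
  WalksIn.toPath H w simple , λ i → WalksIn.toPath-tame H w simple (Q i) (tame i)
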